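{- For all positive integers $n_1,n_2$, the digraph $R_{1,2n_1,2n_2}$ is a transitive orientation of the graph $H_{1,2n_1,2n_2}$. In particular $H_{1,2n_1,2n_2}$ is a comparability graph.
   Context: A transitive orientation of a graph $G$ is a transitive digraph on $V(G)$ obtained by replacing each edge $\{x,y\}$ by exactly one of $(x,y),(y,x)$ (and no other arcs); a comparability graph is a graph admitting one. $D^\star$ denotes the dual of a digraph $D$ (all arcs reversed). For $n\ge0$, $t_n(p)=p+n$ and $t_n(\cdot)$ shifts all vertices by $n$. Put $s_1=n_1$, $s_2=n_1+n_2$. - $G_{2n}$: graph on $\{0,\ldots,2n-1\}$, edges $\{2i,2j+1\}$, $0\le i\le j\le n-1$; $G'_{2n}$: edges $E(G_{2n})\cup\{\{2p-1,2q-1\}:1\le p<q\le n\}$. - $H_{1,2n_1,2n_2}$: graph on $\{0,\ldots,2s_2\}$ with edges $E(t_1(G'_{2n_1}))\cup E(t_{2n_1+1}(G'_{2n_2}))\cup\{\{2p,2q\}:0\le p<q\le s_2\}$. - $Q_{2n}$: digraph on $\{0,\ldots,2n-1\}$, arcs $(2p,2q+1)$, $0\le p\le q\le n-1$; $Q'_{2n}$: arcs $A(Q_{2n})\cup\{(2p-1,2q-1):1\le p<q\le n\}$. - $R_{1,2n_1,2n_2}$: digraph on $\{0,\ldots,2s_2\}$ with arcs $A(t_1(Q'_{2n_1}))\cup A(t_{2n_1+1}((Q'_{2n_2})^\star))\cup\{(0,2p):1\le p\le n_1\}\cup\{(2q,2p):0\le p\le n_1,\ n_1+1\le q\le s_2\}$.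 -}

module Defs where

open import Data.Nat using (ℕ; _+_; _*_; _∸_; _≤_; _<_)
open import Data.Product using (Σ; ∃; ∃₂; _×_)
open import Data.Sum using (_⊎_)
open import Relation.Nullary using (¬_)
open import Relation.Binary.PropositionalEquality using (_≡_)
open import Level using (0ℓ)

-- Graphs and digraphs on an initial segment of ℕ are given by their
-- edge / arc relations on ℕ.  A graph edge relation is symmetric by
-- construction (via Sym).
Rel₀ : Set₁
Rel₀ = ℕ → ℕ → Set

Sym : Rel₀ → Rel₀
Sym R x y = R x y ⊎ R y x

_∪_ : Rel₀ → Rel₀ → Rel₀
(R ∪ S) x y = R x y ⊎ S x y
infixr 5 _∪_

shift : ℕ → Rel₀ → Rel₀
shift k R x y = ∃₂ λ a b → x ≡ a + k × y ≡ b + k × R a b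

dual : Rel₀ → Rel₀
dual D x y = D y x

G-gen : ℕ → Rel₀
G-gen n x y = ∃₂ λ i j → i ≤ j × j < n × x ≡ 2 * i × y ≡ 2 * j + 1

G : ℕ → Rel₀
G n = Sym (G-gen n)

G'-extra : ℕ → Rel₀
G'-extra n x y = ∃₂ λ p q → 1 ≤ p × p < q × q ≤ n × x ≡ 2 * p ∸ 1 × y ≡ 2 * q ∸ 1

G' : ℕ → Rel₀
G' n = G n ∪ Sym (G'-extra n)

evenClique : ℕ → Rel₀
evenClique s x y = ∃₂ λ p q → p < q × q ≤ s × x ≡ 2 * p × y ≡ 2 * q

-- H_{1,2n₁,2n₂} on vertices {0,…,2(n₁+n₂)}
H : ℕ → ℕ → Rel₀
H n₁ n₂ = shift 1 (G' n₁) ∪ shift (2 * n₁ + 1) (G' n₂) ∪ Sym (evenClique (n₁ + n₂))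

Q : ℕ → Rel₀
Q n x y = ∃₂ λ p q → p ≤ q × q < n × x ≡ 2 * p × y ≡ 2 * q + 1

Q' : ℕ → Rel₀
Q' n = Q n ∪ G'-extra n

R-arcs₁ : ℕ → Rel₀
R-arcs₁ n₁ x y = Σ ℕ λ p → 1 ≤ p × p ≤ n₁ × x ≡ 0 × y ≡ 2 * p

R-arcs₂ : ℕ → ℕ → Rel₀
R-arcs₂ n₁ n₂ x y = ∃₂ λ p q → p ≤ n₁ × n₁ + 1 ≤ q × q ≤ n₁ + n₂ × x ≡ 2 * q × y ≡ 2 * p

R : ℕ → ℕ → Rel₀
R n₁ n₂ = shift 1 (Q' n₁) ∪ shift (2 * n₁ + 1) (dual (Q' n₂)) ∪ R-arcs₁ n₁ ∪ R-arcs₂ n₁ n₂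

record IsTransitiveOrientation (E D : Rel₀) : Set where
  field
    arcs⊆edges  : ∀ x y → D x y → E x y
    exactlyOne  : ∀ x y → E x y → (D x y × ¬ D y x) ⊎ (D y x × ¬ D x y)
    transitive  : ∀ x y z → D x y → D y z → D x z

IsComparabilityGraph : Rel₀ → Set₁
IsComparabilityGraph E = Σ Rel₀ λ D → IsTransitiveOrientation E D

{-# OPTIONS --safe #-}
-- Index a vertex by half its label, as 2a or 2a + 1.  The arcs of R then become
-- five families of inequalities between halves: the even vertices of the first
-- block form an increasing chain, the even vertices of the second block a
-- decreasing chain lying below it, an odd vertex 2p + 1 of the first block lies
-- below the first-block even vertices 2b with p < b, and an odd vertex
-- 2p + 1 of the second block lies above the second-block even vertices 2a
-- with p < a.  Transitivity and irreflexivity of this order are inherited from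
-- < on ℕ, and every edge of H is an arc in one direction; for the even clique
-- this is because any two even vertices lie on the chain just described.
module Submission where

open import Defs
open import Data.Nat using (ℕ; zero; suc; _+_; _*_; _∸_; _≤_; _<_; z≤n; s≤s; _≤?_)
open import Data.Nat.Properties
open import Data.Product using (_×_; _,_; ∃₂; ∃-syntax)
open import Data.Sum using (_⊎_; inj₁; inj₂; swap) renaming (map to ⊎-map)
open import Data.Empty using (⊥-elim)
open import Function using (_∘_)
open import Relation.Binary.Core using (_⇒_)
open import Relation.Binary.Definitions using (Transitive; Irreflexive; Asymmetric; Symmetric)
open import Relation.Binary.Consequences using (trans∧irr⇒asym)
open import Relation.Binary.PropositionalEquality using (_≡_; refl; sym; trans; cong; subst; module ≡-Reasoning)
open import Relation.Nullary using (¬_; yes; no)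

transitiveOrientation : ∀ {E D : Rel₀} → D ⇒ E → E ⇒ Sym D →
  Transitive D → Asymmetric D → IsTransitiveOrientation E D
transitiveOrientation {E} {D} D⇒E E⇒SymD D-trans D-asym = record
  { arcs⊆edges = λ _ _ → D⇒E
  ; exactlyOne = λ _ _ → orient ∘ E⇒SymD
  ; transitive = λ _ _ _ → D-trans
  }
  where
  orient : ∀ {x y} → Sym D x y → (D x y × ¬ D y x) ⊎ (D y x × ¬ D x y)
  orient (inj₁ d) = inj₁ (d , D-asym d)
  orient (inj₂ d) = inj₂ (d , D-asym d)

shift-mono : ∀ {k} {D E : Rel₀} → D ⇒ E → shift k D ⇒ shift k E
shift-mono D⇒E (a , b , x≡ , y≡ , d) = a , b , x≡ , y≡ , D⇒E d

shift-Sym : ∀ {k} {D E : Rel₀} → E ⇒ Sym D → shift k E ⇒ Sym (shift k D)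
shift-Sym E⇒SymD (a , b , x≡ , y≡ , e) with E⇒SymD e
... | inj₁ d = inj₁ (a , b , x≡ , y≡ , d)
... | inj₂ d = inj₂ (b , a , y≡ , x≡ , d)

Q'⇒G' : ∀ {n} → Q' n ⇒ G' n
Q'⇒G' (inj₁ q) = inj₁ (inj₁ q)
Q'⇒G' (inj₂ e) = inj₂ (inj₁ e)

G'-sym : ∀ {n} → Symmetric (G' n)
G'-sym = ⊎-map swap swap

G'⇒SymQ' : ∀ {n} → G' n ⇒ Sym (Q' n)
G'⇒SymQ' (inj₁ (inj₁ g)) = inj₁ (inj₁ g)
G'⇒SymQ' (inj₁ (inj₂ g)) = inj₂ (inj₁ g)
G'⇒SymQ' (inj₂ (inj₁ e)) = inj₁ (inj₂ e)
G'⇒SymQ' (inj₂ (inj₂ e)) = inj₂ (inj₂ e)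

data Vertex : Set where
  even odd : ℕ → Vertex

⟦_⟧ : Vertex → ℕ
⟦ even a ⟧ = 2 * a
⟦ odd a ⟧  = 2 * a + 1

⟦⟧-injective : ∀ {u v} → ⟦ u ⟧ ≡ ⟦ v ⟧ → u ≡ v
⟦⟧-injective {even a} {even b} eq = cong even (*-cancelˡ-≡ a b 2 eq)
⟦⟧-injective {even a} {odd b}  eq = ⊥-elim (even≢odd a b (trans eq (+-comm (2 * b) 1)))
⟦⟧-injective {odd a}  {even b} eq = ⊥-elim (even≢odd b a (trans (sym eq) (+-comm (2 * a) 1)))
⟦⟧-injective {odd a}  {odd b}  eq = cong odd (*-cancelˡ-≡ a b 2 (+-cancelʳ-≡ 1 (2 * a) (2 * b) eq))

Encoded : (Vertex → Vertex → Set) → Rel₀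
Encoded _∼_ x y = ∃₂ λ u v → x ≡ ⟦ u ⟧ × y ≡ ⟦ v ⟧ × u ∼ v

module _ {_∼_ : Vertex → Vertex → Set} where

  Encoded-trans : Transitive _∼_ → Transitive (Encoded _∼_)
  Encoded-trans ∼-trans (u , v , refl , refl , u∼v) (v' , w , v≡v' , refl , v'∼w)
    with refl ← ⟦⟧-injective {v} {v'} v≡v' = u , w , refl , refl , ∼-trans u∼v v'∼w

  Encoded-irrefl : (∀ {u} → ¬ u ∼ u) → Irreflexive _≡_ (Encoded _∼_)
  Encoded-irrefl ∼-irrefl refl (u , v , refl , u≡v , u∼v)
    with refl ← ⟦⟧-injective {u} {v} u≡v = ∼-irrefl u∼v

2*-suc : ∀ q → 2 * q + 1 + 1 ≡ 2 * suc q
2*-suc q = trans (+-assoc (2 * q) 1 1) (trans (+-comm (2 * q) 2) (sym (*-suc 2 q)))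

2*∸1+1 : ∀ {p} → 1 ≤ p → 2 * p ∸ 1 + 1 ≡ 2 * p
2*∸1+1 {p} 1≤p = m∸n+n≡m (≤-trans 1≤p (m≤n*m p 2))

+2*+1-even : ∀ {m a} n → m + 1 ≡ 2 * a → m + (2 * n + 1) ≡ 2 * (n + a)
+2*+1-even {m} {a} n m+1≡2a = begin
  m + (2 * n + 1)  ≡⟨ cong (m +_) (+-comm (2 * n) 1) ⟩
  m + (1 + 2 * n)  ≡⟨ sym (+-assoc m 1 (2 * n)) ⟩
  m + 1 + 2 * n    ≡⟨ cong (_+ 2 * n) m+1≡2a ⟩
  2 * a + 2 * n    ≡⟨ +-comm (2 * a) (2 * n) ⟩
  2 * n + 2 * a    ≡⟨ sym (*-distribˡ-+ 2 n a) ⟩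
  2 * (n + a)      ∎
  where open ≡-Reasoning

+2*+1-odd : ∀ p n → 2 * p + (2 * n + 1) ≡ 2 * (n + p) + 1
+2*+1-odd p n = begin
  2 * p + (2 * n + 1)  ≡⟨ sym (+-assoc (2 * p) (2 * n) 1) ⟩
  2 * p + 2 * n + 1    ≡⟨ cong (_+ 1) (+-comm (2 * p) (2 * n)) ⟩
  2 * n + 2 * p + 1    ≡⟨ cong (_+ 1) (sym (*-distribˡ-+ 2 n p)) ⟩
  2 * (n + p) + 1      ∎
  where open ≡-Reasoning

m+1≤n⇒m<n : ∀ {m n} → m + 1 ≤ n → m < n
m+1≤n⇒m<n {m} {n} = subst (_≤ n) (+-comm m 1)

m<n⇒∃[o]n≡m+suc[o] : ∀ {m n} → m < n → ∃[ o ] n ≡ m + suc o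
m<n⇒∃[o]n≡m+suc[o] {m} m<n with o , m+1+o≡n ← m≤n⇒∃[o]m+o≡n m<n =
  o , trans (sym m+1+o≡n) (sym (+-suc m o))

module Orientation (n₁ n₂ : ℕ) where

  -- The arcs of R on half-labels: low comes from (0,2p) and t₁ of the arcs
  -- (2p-1,2q-1) of Q'_{2n₁}, lowOdd from t₁(Q_{2n₁}), down from the arcs (2q,2p)
  -- between the blocks, and high, highOdd from t_{2n₁+1}((Q'_{2n₂})⋆).
  data _≺_ : Vertex → Vertex → Set where
    low     : ∀ {a b} → a < b → b ≤ n₁ → even a ≺ even b
    down    : ∀ {a b} → n₁ < a → a ≤ n₁ + n₂ → b ≤ n₁ → even a ≺ even b
    high    : ∀ {a b} → n₁ < b → b < a → a ≤ n₁ + n₂ → even a ≺ even b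
    lowOdd  : ∀ {p b} → p < b → b ≤ n₁ → odd p ≺ even b
    highOdd : ∀ {a p} → n₁ ≤ p → p < a → a ≤ n₁ + n₂ → even a ≺ odd p

  ≺-trans : Transitive _≺_
  ≺-trans (low a<b _)      (low b<c c≤n)        = low (<-trans a<b b<c) c≤n
  ≺-trans (down n<a a≤s _) (low _ c≤n)          = down n<a a≤s c≤n
  ≺-trans (lowOdd p<b _)   (low b<c c≤n)        = lowOdd (<-trans p<b b<c) c≤n
  ≺-trans (high n<b b<a a≤s) (down _ _ c≤n)     = down (<-trans n<b b<a) a≤s c≤n
  ≺-trans (high _ b<a a≤s) (high n<c c<b _)     = high n<c (<-trans c<b b<a) a≤s
  ≺-trans (high _ b<a a≤s) (highOdd n≤p p<b _)  = highOdd n≤p (<-trans p<b b<a) a≤s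
  ≺-trans (high n<b _ _)   (low b<c c≤n)        = ⊥-elim (≤⇒≯ (≤-trans (<⇒≤ b<c) c≤n) n<b)
  ≺-trans (highOdd n≤p _ _) (lowOdd p<b b≤n)    = ⊥-elim (≤⇒≯ b≤n (≤-<-trans n≤p p<b))
  ≺-trans (low _ b≤n)      (down n<b _ _)       = ⊥-elim (≤⇒≯ b≤n n<b)
  ≺-trans (low _ b≤n)      (high n<c c<b _)     = ⊥-elim (≤⇒≯ b≤n (<-trans n<c c<b))
  ≺-trans (low _ b≤n)      (highOdd n≤p p<b _)  = ⊥-elim (≤⇒≯ b≤n (≤-<-trans n≤p p<b))
  ≺-trans (down _ _ b≤n)   (down n<b _ _)       = ⊥-elim (≤⇒≯ b≤n n<b)
  ≺-trans (down _ _ b≤n)   (high n<c c<b _)     = ⊥-elim (≤⇒≯ b≤n (<-trans n<c c<b))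
  ≺-trans (down _ _ b≤n)   (highOdd n≤p p<b _)  = ⊥-elim (≤⇒≯ b≤n (≤-<-trans n≤p p<b))
  ≺-trans (lowOdd _ b≤n)   (down n<b _ _)       = ⊥-elim (≤⇒≯ b≤n n<b)
  ≺-trans (lowOdd _ b≤n)   (high n<c c<b _)     = ⊥-elim (≤⇒≯ b≤n (<-trans n<c c<b))
  ≺-trans (lowOdd _ b≤n)   (highOdd n≤p p<b _)  = ⊥-elim (≤⇒≯ b≤n (≤-<-trans n≤p p<b))

  ≺-irrefl : ∀ {u} → ¬ u ≺ u
  ≺-irrefl (low a<a _)      = <-irrefl refl a<a
  ≺-irrefl (down n<a _ a≤n) = ≤⇒≯ a≤n n<a
  ≺-irrefl (high _ a<a _)   = <-irrefl refl a<a

  evenClique-≺ : ∀ {p q} → p < q → q ≤ n₁ + n₂ → even p ≺ even q ⊎ even q ≺ even p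
  evenClique-≺ {p} {q} p<q q≤s with q ≤? n₁ | p ≤? n₁
  ... | yes q≤n | _       = inj₁ (low p<q q≤n)
  ... | no q≰n  | yes p≤n = inj₂ (down (≰⇒> q≰n) q≤s p≤n)
  ... | no q≰n  | no p≰n  = inj₂ (high (≰⇒> p≰n) p<q q≤s)

  R⇒Encoded : R n₁ n₂ ⇒ Encoded _≺_
  R⇒Encoded (inj₁ (_ , _ , refl , refl , inj₁ (p , q , p≤q , q<n , refl , refl))) =
    odd p , even (suc q) , refl , 2*-suc q , lowOdd (s≤s p≤q) q<n
  R⇒Encoded (inj₁ (_ , _ , refl , refl , inj₂ (p , q , 1≤p , p<q , q≤n , refl , refl))) =
    even p , even q , 2*∸1+1 1≤p , 2*∸1+1 (≤-trans 1≤p (<⇒≤ p<q)) , low p<q q≤n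
  R⇒Encoded (inj₂ (inj₁ (_ , _ , refl , refl , inj₁ (p , q , p≤q , q<n , refl , refl)))) =
    even (n₁ + suc q) , odd (n₁ + p) , +2*+1-even n₁ (2*-suc q) , +2*+1-odd p n₁ ,
    highOdd (m≤m+n n₁ p) (+-monoʳ-< n₁ (s≤s p≤q)) (+-monoʳ-≤ n₁ q<n)
  R⇒Encoded (inj₂ (inj₁ (_ , _ , refl , refl , inj₂ (p , q , 1≤p , p<q , q≤n , refl , refl)))) =
    even (n₁ + q) , even (n₁ + p) ,
    +2*+1-even n₁ (2*∸1+1 (≤-trans 1≤p (<⇒≤ p<q))) , +2*+1-even n₁ (2*∸1+1 1≤p) ,
    high (m<m+n n₁ 1≤p) (+-monoʳ-< n₁ p<q) (+-monoʳ-≤ n₁ q≤n)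
  R⇒Encoded (inj₂ (inj₂ (inj₁ (p , 1≤p , p≤n , refl , refl)))) =
    even 0 , even p , refl , refl , low 1≤p p≤n
  R⇒Encoded (inj₂ (inj₂ (inj₂ (p , q , p≤n , n+1≤q , q≤s , refl , refl)))) =
    even q , even p , refl , refl , down (m+1≤n⇒m<n n+1≤q) q≤s p≤n

  ≺⇒R : ∀ {u v} → u ≺ v → R n₁ n₂ ⟦ u ⟧ ⟦ v ⟧
  ≺⇒R (low {zero} 0<b b≤n) = inj₂ (inj₂ (inj₁ (_ , 0<b , b≤n , refl , refl)))
  ≺⇒R (low {suc a} a<b b≤n) =
    inj₁ (_ , _ , sym (2*∸1+1 (s≤s z≤n)) , sym (2*∸1+1 (≤-trans (s≤s z≤n) (<⇒≤ a<b))) ,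
          inj₂ (suc a , _ , s≤s z≤n , a<b , b≤n , refl , refl))
  ≺⇒R (down {a} n<a a≤s b≤n) =
    inj₂ (inj₂ (inj₂ (_ , _ , b≤n , subst (_≤ a) (+-comm 1 n₁) n<a , a≤s , refl , refl)))
  ≺⇒R (lowOdd {p} {suc q} (s≤s p≤q) q<n) =
    inj₁ (_ , _ , refl , sym (2*-suc q) , inj₁ (p , q , p≤q , q<n , refl , refl))
  ≺⇒R (high n<b b<a a≤s)
    with p , refl ← m<n⇒∃[o]n≡m+suc[o] n<b
       | q , refl ← m<n⇒∃[o]n≡m+suc[o] (<-trans n<b b<a) =
    inj₂ (inj₁ (_ , _ , sym (+2*+1-even n₁ (2*∸1+1 (s≤s z≤n))) ,
                        sym (+2*+1-even n₁ (2*∸1+1 (s≤s z≤n))) ,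
                inj₂ (suc p , suc q , s≤s z≤n , +-cancelˡ-< n₁ _ _ b<a ,
                      +-cancelˡ-≤ n₁ _ _ a≤s , refl , refl)))
  ≺⇒R (highOdd n≤p p<a a≤s)
    with p , refl ← m≤n⇒∃[o]m+o≡n n≤p
       | q , refl ← m<n⇒∃[o]n≡m+suc[o] (≤-<-trans n≤p p<a)
    with s≤s p≤q ← +-cancelˡ-< n₁ _ _ p<a =
    inj₂ (inj₁ (_ , _ , sym (+2*+1-even n₁ (2*-suc q)) , sym (+2*+1-odd p n₁) ,
                inj₁ (p , q , p≤q , +-cancelˡ-≤ n₁ _ _ a≤s , refl , refl)))

  Encoded⇒R : Encoded _≺_ ⇒ R n₁ n₂
  Encoded⇒R (_ , _ , refl , refl , u≺v) = ≺⇒R u≺v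

  R-trans : Transitive (R n₁ n₂)
  R-trans r s = Encoded⇒R (Encoded-trans ≺-trans (R⇒Encoded r) (R⇒Encoded s))

  R-asym : Asymmetric (R n₁ n₂)
  R-asym r s = Encoded-asym (R⇒Encoded r) (R⇒Encoded s)
    where
    Encoded-asym : Asymmetric (Encoded _≺_)
    Encoded-asym = trans∧irr⇒asym {_≈_ = _≡_} refl (Encoded-trans ≺-trans) (Encoded-irrefl ≺-irrefl)

  R⇒H : R n₁ n₂ ⇒ H n₁ n₂
  R⇒H (inj₁ r)        = inj₁ (shift-mono Q'⇒G' r)
  R⇒H (inj₂ (inj₁ r)) = inj₂ (inj₁ (shift-mono (G'-sym ∘ Q'⇒G') r))
  R⇒H (inj₂ (inj₂ (inj₁ (p , 1≤p , p≤n , refl , refl)))) =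
    inj₂ (inj₂ (inj₁ (0 , p , 1≤p , ≤-trans p≤n (m≤m+n n₁ n₂) , refl , refl)))
  R⇒H (inj₂ (inj₂ (inj₂ (p , q , p≤n , n+1≤q , q≤s , refl , refl)))) =
    inj₂ (inj₂ (inj₂ (p , q , ≤-<-trans p≤n (m+1≤n⇒m<n n+1≤q) , q≤s , refl , refl)))

  evenClique⇒SymR : evenClique (n₁ + n₂) ⇒ Sym (R n₁ n₂)
  evenClique⇒SymR (p , q , p<q , q≤s , refl , refl) = ⊎-map ≺⇒R ≺⇒R (evenClique-≺ p<q q≤s)

  H⇒SymR : H n₁ n₂ ⇒ Sym (R n₁ n₂)
  H⇒SymR (inj₁ h)               = ⊎-map inj₁ inj₁ (shift-Sym G'⇒SymQ' h)
  H⇒SymR (inj₂ (inj₁ h))        = ⊎-map (inj₂ ∘ inj₁) (inj₂ ∘ inj₁) (shift-Sym (swap ∘ G'⇒SymQ') h)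
  H⇒SymR (inj₂ (inj₂ (inj₁ c))) = evenClique⇒SymR c
  H⇒SymR (inj₂ (inj₂ (inj₂ c))) = swap (evenClique⇒SymR c)

  isTransitiveOrientation : IsTransitiveOrientation (H n₁ n₂) (R n₁ n₂)
  isTransitiveOrientation = transitiveOrientation R⇒H H⇒SymR R-trans R-asym

mainTheorem6 : ∀ (n₁ n₂ : ℕ) → 1 ≤ n₁ → 1 ≤ n₂ →
    IsTransitiveOrientation (H n₁ n₂) (R n₁ n₂) × IsComparabilityGraph (H n₁ n₂)
mainTheorem6 n₁ n₂ _ _ = isTransitiveOrientation , (R n₁ n₂ , isTransitiveOrientation)
  where open Orientation n₁ n₂
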